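{- Let $G=(V,E)$ be a graph, $C$ a clique of $G$, and $v\notin V$. Let $G_{C\triangleright v}$ be the graph with vertex set $V\cup\{v\}$ and edge set $E\cup\{uv\mid u\in C\}$. Then \[N_{G_{C\triangleright v}}(x)=N_G(x)+\phi_G(C)+x\sum_{A\in\mathcal{A}_G(C)}P_G(A,C,x)\left((1+x)^{|C|}-x^{|A|}(1+x)^{|C|-|A|}\right),\] where $\phi_G(C)=x^{|C|}$ if $C$ is a maximal clique of $G$ and $\phi_G(C)=0$ otherwise.
   Context: All graphs are finite, simple and undirected; $N_G(v)$ is the set of neighbors of $v$. The neighborhood complex is $\mathcal{N}_G=\{U\subseteq V\mid\exists w\in V: U\subseteq N_G(w)\}$ and the neighborhood polynomial is $N_G(x)=\sum_{U\in\mathcal{N}_G}x^{|U|}$. For $W\subseteq V$ let $N_G^{\cap}(W)=\bigcap_{w\in W}N_G(w)$ (with $N_G^{\cap}(\emptyset)=V$) and $N_G^{\cup}(W)=\bigcup_{w\in W}N_G(w)$. For a clique $C$, the periphery is $P_G(C)=N_G^{\cup}(C)\setminus C$; for $M\subseteq P_G(C)$ the corresponding anchor set is $A_G(M,C)=N_G^{\cap}(M)\cap C$ when non-empty; $\mathcal{A}_G(C)=\{A\subseteq C\mid A\neq\emptyset,\ \exists M\subseteq P_G(C): A=A_G(M,C)\}$; $\mathcal{P}_G(A,C)=\{M\subseteq P_G(C)\mid A_G(M,C)=A\}$ and the periphery polynomial is $P_G(A,C,x)=\sum_{M\in\mathcal{P}_G(A,C)}x^{|M|}$. -}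

module Defs where

open import Data.Bool using (Bool; true; false)
open import Data.Nat using (ℕ; zero; suc; _∸_)
open import Data.Integer using (ℤ; _+_; _*_; _-_; _^_; 0ℤ; 1ℤ)
open import Data.Fin using (Fin; zero; suc)
open import Data.Fin.Subset using (Subset; _∈_; _∉_; _⊆_; _∩_; _─_; inside; outside; ∣_∣; Nonempty)
open import Data.Fin.Subset.Properties using (_∈?_; _⊆?_; nonempty?)
open import Data.Fin.Properties using (all?; any?)
open import Data.List using (List; []; _∷_; [_]; _++_; map; filter; foldr)
open import Data.List.Relation.Unary.Any using (Any)
open import Data.List.Relation.Unary.Any as Any using ()
open import Data.Vec using ([]; _∷_; tabulate)
open import Data.Vec.Properties using (≡-dec)
open import Data.Product using (Σ; _×_; _,_; ∃)
open import Relation.Nullary using (Dec; yes; no; ¬_; does)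
open import Relation.Nullary.Decidable using (_×-dec_; _→-dec_)
open import Relation.Binary.PropositionalEquality using (_≡_; _≢_; refl)
import Data.Bool as B

record Graph (n : ℕ) : Set where
  field
    adj    : Fin n → Fin n → Bool
    sym    : ∀ u w → adj u w ≡ adj w u
    irrefl : ∀ u → adj u u ≡ false
open Graph public

Nbh : ∀ {n} → Graph n → Fin n → Subset n
Nbh G w = tabulate (adj G w)

-- N_G^∩(W) = ⋂_{w∈W} N_G(w)  (equal to V when W = ∅)
Ncap : ∀ {n} → Graph n → Subset n → Subset n
Ncap G W = tabulate λ u → does (all? λ w → w ∈? W →-dec u ∈? Nbh G w)

Ncup : ∀ {n} → Graph n → Subset n → Subset n
Ncup G W = tabulate λ u → does (any? λ w → w ∈? W ×-dec u ∈? Nbh G w)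

allSubsets : ∀ n → List (Subset n)
allSubsets zero    = [ [] ]
allSubsets (suc n) = map (outside ∷_) (allSubsets n) ++ map (inside ∷_) (allSubsets n)

sumℤ : List ℤ → ℤ
sumℤ = foldr _+_ 0ℤ

_≟ₛ_ : ∀ {n} (A B : Subset n) → Dec (A ≡ B)
_≟ₛ_ = ≡-dec B._≟_

InNbhComplex : ∀ {n} → Graph n → Subset n → Set
InNbhComplex G U = ∃ λ w → U ⊆ Nbh G w

inNbhComplex? : ∀ {n} (G : Graph n) (U : Subset n) → Dec (InNbhComplex G U)
inNbhComplex? G U = any? λ w → U ⊆? Nbh G w

nbhPoly : ∀ {n} → Graph n → ℤ → ℤ
nbhPoly {n} G x = sumℤ (map (λ U → x ^ ∣ U ∣) (filter (inNbhComplex? G) (allSubsets n)))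

IsClique : ∀ {n} → Graph n → Subset n → Set
IsClique G C = ∀ u w → u ∈ C → w ∈ C → u ≢ w → adj G u w ≡ true

IsMaximalClique : ∀ {n} → Graph n → Subset n → Set
IsMaximalClique G C = IsClique G C × (∀ D → IsClique G D → C ⊆ D → D ⊆ C)

φ : ∀ {n} (G : Graph n) (C : Subset n) → Dec (IsMaximalClique G C) → ℤ → ℤ
φ G C (yes _) x = x ^ ∣ C ∣
φ G C (no _)  x = 0ℤ

periphery : ∀ {n} → Graph n → Subset n → Subset n
periphery G C = Ncup G C ─ C

anchor : ∀ {n} → Graph n → Subset n → Subset n → Subset n
anchor G M C = Ncap G M ∩ C

InPeriphSets : ∀ {n} → Graph n → Subset n → Subset n → Subset n → Set
InPeriphSets G A C M = M ⊆ periphery G C × anchor G M C ≡ A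

inPeriphSets? : ∀ {n} (G : Graph n) (A C M : Subset n) → Dec (InPeriphSets G A C M)
inPeriphSets? G A C M = (M ⊆? periphery G C) ×-dec (anchor G M C ≟ₛ A)

InAnchors : ∀ {n} → Graph n → Subset n → Subset n → Set
InAnchors {n} G C A = A ⊆ C × Nonempty A × Any (InPeriphSets G A C) (allSubsets n)

inAnchors? : ∀ {n} (G : Graph n) (C A : Subset n) → Dec (InAnchors G C A)
inAnchors? {n} G C A = (A ⊆? C) ×-dec (nonempty? A ×-dec Any.any? (inPeriphSets? G A C) (allSubsets n))

periphPoly : ∀ {n} → Graph n → Subset n → Subset n → ℤ → ℤ
periphPoly {n} G A C x = sumℤ (map (λ M → x ^ ∣ M ∣) (filter (inPeriphSets? G A C) (allSubsets n)))

-- G_{C▷v}: new vertex v is `zero`, old vertex u is `suc u`;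
-- edges E ∪ {uv | u ∈ C}.

inC : ∀ {n} → Subset n → Fin n → Bool
inC C u = does (u ∈? C)

extAdj : ∀ {n} → Graph n → Subset n → Fin (suc n) → Fin (suc n) → Bool
extAdj G C zero    zero    = false
extAdj G C zero    (suc w) = inC C w
extAdj G C (suc u) zero    = inC C u
extAdj G C (suc u) (suc w) = adj G u w

extSym : ∀ {n} (G : Graph n) (C : Subset n) u w → extAdj G C u w ≡ extAdj G C w u
extSym G C zero    zero    = refl
extSym G C zero    (suc w) = refl
extSym G C (suc u) zero    = refl
extSym G C (suc u) (suc w) = sym G u w

extIrrefl : ∀ {n} (G : Graph n) (C : Subset n) u → extAdj G C u u ≡ false
extIrrefl G C zero    = refl
extIrrefl G C (suc u) = irrefl G u

addVertex : ∀ {n} → Graph n → Subset n → Graph (suc n)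
addVertex G C = record { adj = extAdj G C ; sym = extSym G C ; irrefl = extIrrefl G C }

-- Split the faces of the neighbourhood complex of G_{C▷v} by whether they contain v.
-- A face avoiding v is a face of G or C = N(v) itself, and C is a new face exactly when
-- C is a maximal clique: this gives N_G(x) + φ_G(C).  A face {v} ∪ M ∪ S with M ∩ C = ∅,
-- S ⊆ C must lie in N(u) for some u ∈ C; as C is a clique this happens iff M lies in
-- the periphery and some u ∈ A_G(M,C) is missing from S.  For fixed M the admissible S
-- contribute (1+x)^|C| − x^|A|(1+x)^(|C|−|A|) with A = A_G(M,C), and grouping the M
-- by their anchor set A yields the periphery polynomials.

module Submission where

open import Defs hiding (sym)
open import Data.Bool using (Bool; true; false; _∧_; not)
open import Data.Nat as ℕ using (ℕ; zero; suc; _∸_)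
import Data.Nat.Properties as ℕ
open import Data.Integer using (ℤ; _+_; _*_; _-_; -_; _^_; 0ℤ; 1ℤ)
import Data.Integer.Properties as ℤ
open import Data.Integer.Tactic.RingSolver using (solve-∀)
open import Algebra.Properties.CommutativeSemigroup ℤ.+-commutativeSemigroup using (interchange)
open import Data.Fin using (Fin; zero; suc)
open import Data.Fin.Subset
  using (Subset; inside; outside; ∣_∣; _∈_; _∉_; _⊆_; ∁; _∪_; _─_; ⊥; ⁅_⁆; Nonempty)
open import Data.Fin.Subset.Properties
  using ( _∈?_; _⊆?_; nonempty?; drop-∷-⊆; p⊆q⇒∣p∣≤∣q∣; Empty-unique; ∣⊥∣≡0; ⊆-antisym
        ; ⊥⊆; x∈p∪q⁻; x∈p∪q⁺; x∈p∩q⁻; x∈p∩q⁺; x∈∁p⇒x∉p; x∉p⇒x∈∁p; x∈⁅x⁆; x∈⁅y⁆⇒x≡y)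
open import Data.Fin.Properties using (all?; any?)
open import Data.List using (List; []; _∷_; _++_; map; filter)
import Data.List.Relation.Unary.Any as Any
open import Data.List.Membership.Propositional using (lose) renaming (_∈_ to _∈ₗ_)
open import Data.List.Membership.Propositional.Properties using (∈-map⁺; ∈-++⁺ˡ; ∈-++⁺ʳ)
open import Data.Vec using ([]; _∷_; tabulate; here; there)
open import Data.Vec.Properties using ([]=⇒lookup; lookup⇒[]=; lookup∘tabulate)
open import Data.Product using (∃; _×_; _,_; proj₁; proj₂)
open import Data.Sum using (inj₁; inj₂)
open import Function.Bundles using (_⇔_; mk⇔)
open import Function.Properties.Equivalence using () renaming (trans to ⇔-trans)
open import Relation.Nullary using (Dec; yes; no; does; ¬_; ¬?; contradiction)
open import Relation.Nullary.Decidable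
  using (_×-dec_; _→-dec_; dec-true; dec-false; does-⇔; decidable-stable)
open import Relation.Unary using (Pred; Decidable)
open import Relation.Binary.PropositionalEquality
  using (_≡_; _≢_; refl; sym; trans; cong; cong₂; module ≡-Reasoning)

𝟙[_]_ : Bool → ℤ → ℤ
𝟙[ true  ] v = v
𝟙[ false ] v = 0ℤ

𝟙-0 : ∀ b → 𝟙[ b ] 0ℤ ≡ 0ℤ
𝟙-0 true  = refl
𝟙-0 false = refl

𝟙-*ˡ : ∀ b c v → c * 𝟙[ b ] v ≡ 𝟙[ b ] (c * v)
𝟙-*ˡ true  c v = refl
𝟙-*ˡ false c v = ℤ.*-zeroʳ c

𝟙-*ʳ : ∀ b v c → 𝟙[ b ] v * c ≡ 𝟙[ b ] (v * c)
𝟙-*ʳ true  v c = refl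
𝟙-*ʳ false v c = ℤ.*-zeroˡ c

𝟙-∧ : ∀ a b v → 𝟙[ a ∧ b ] v ≡ 𝟙[ a ] (𝟙[ b ] v)
𝟙-∧ true  b v = refl
𝟙-∧ false b v = refl

𝟙-comm : ∀ a b v → 𝟙[ a ] (𝟙[ b ] v) ≡ 𝟙[ b ] (𝟙[ a ] v)
𝟙-comm true  b     v = refl
𝟙-comm false true  v = refl
𝟙-comm false false v = refl

𝟙-true : ∀ {P : Set} (P? : Dec P) → P → ∀ v → 𝟙[ does P? ] v ≡ v
𝟙-true P? p v rewrite dec-true P? p = refl

dec-true⁻ : ∀ {P : Set} (P? : Dec P) → does P? ≡ true → P
dec-true⁻ (yes p) _ = p

-- Finite sums

∑ : ∀ {A : Set} → List A → (A → ℤ) → ℤ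
∑ xs f = sumℤ (map f xs)

module _ {A : Set} where

  ∑-filter : ∀ {p} {P : Pred A p} (P? : Decidable P) (f : A → ℤ) (xs : List A) →
    sumℤ (map f (filter P? xs)) ≡ ∑ xs (λ a → 𝟙[ does (P? a) ] (f a))
  ∑-filter P? f []       = refl
  ∑-filter P? f (a ∷ xs) with does (P? a)
  ... | true  = cong (f a +_) (∑-filter P? f xs)
  ... | false = trans (∑-filter P? f xs) (sym (ℤ.+-identityˡ _))

  ∑-cong : ∀ (xs : List A) {f g : A → ℤ} → (∀ a → f a ≡ g a) → ∑ xs f ≡ ∑ xs g
  ∑-cong []       f≗g = refl
  ∑-cong (a ∷ xs) f≗g = cong₂ _+_ (f≗g a) (∑-cong xs f≗g)

  ∑-zero : ∀ (xs : List A) {f : A → ℤ} → (∀ a → f a ≡ 0ℤ) → ∑ xs f ≡ 0ℤ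
  ∑-zero []       f≗0 = refl
  ∑-zero (a ∷ xs) f≗0 = cong₂ _+_ (f≗0 a) (∑-zero xs f≗0)

  ∑-+ : ∀ (xs : List A) (f g : A → ℤ) → ∑ xs (λ a → f a + g a) ≡ ∑ xs f + ∑ xs g
  ∑-+ []       f g = refl
  ∑-+ (a ∷ xs) f g =
    trans (cong (f a + g a +_) (∑-+ xs f g)) (interchange (f a) (g a) (∑ xs f) (∑ xs g))

  ∑-*ˡ : ∀ (xs : List A) (c : ℤ) (f : A → ℤ) → ∑ xs (λ a → c * f a) ≡ c * ∑ xs f
  ∑-*ˡ []       c f = sym (ℤ.*-zeroʳ c)
  ∑-*ˡ (a ∷ xs) c f =
    trans (cong (c * f a +_) (∑-*ˡ xs c f)) (sym (ℤ.*-distribˡ-+ c (f a) (∑ xs f)))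

  ∑-*ʳ : ∀ (xs : List A) (c : ℤ) (f : A → ℤ) → ∑ xs (λ a → f a * c) ≡ ∑ xs f * c
  ∑-*ʳ xs c f = trans (∑-cong xs (λ a → ℤ.*-comm (f a) c)) (trans (∑-*ˡ xs c f) (ℤ.*-comm c _))

  ∑-𝟙 : ∀ (xs : List A) (b : Bool) (f : A → ℤ) → ∑ xs (λ a → 𝟙[ b ] (f a)) ≡ 𝟙[ b ] (∑ xs f)
  ∑-𝟙 xs true  f = refl
  ∑-𝟙 xs false f = ∑-zero xs (λ _ → refl)

  ∑-𝟙²-*ˡ : ∀ (xs : List A) (c : ℤ) (p q : A → Bool) (f : A → ℤ) →
    ∑ xs (λ a → 𝟙[ p a ] (𝟙[ q a ] (c * f a))) ≡ c * ∑ xs (λ a → 𝟙[ p a ] (𝟙[ q a ] (f a)))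
  ∑-𝟙²-*ˡ xs c p q f = trans
    (∑-cong xs (λ a → sym (trans (𝟙-*ˡ (p a) c _) (cong 𝟙[ p a ]_ (𝟙-*ˡ (q a) c (f a))))))
    (∑-*ˡ xs c _)

  ∑-neg : ∀ (xs : List A) (f : A → ℤ) → ∑ xs (λ a → - f a) ≡ - ∑ xs f
  ∑-neg []       f = refl
  ∑-neg (a ∷ xs) f = trans (cong (- f a +_) (∑-neg xs f)) (sym (ℤ.neg-distrib-+ (f a) (∑ xs f)))

  ∑-- : ∀ (xs : List A) (f g : A → ℤ) → ∑ xs (λ a → f a - g a) ≡ ∑ xs f - ∑ xs g
  ∑-- xs f g = trans (∑-+ xs f (λ a → - g a)) (cong (∑ xs f +_) (∑-neg xs g))

  ∑-++ : ∀ (xs ys : List A) (f : A → ℤ) → ∑ (xs ++ ys) f ≡ ∑ xs f + ∑ ys f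
  ∑-++ []       ys f = sym (ℤ.+-identityˡ _)
  ∑-++ (a ∷ xs) ys f = trans (cong (f a +_) (∑-++ xs ys f)) (sym (ℤ.+-assoc (f a) _ _))

  ∑-map : ∀ {B : Set} (h : B → A) (xs : List B) (f : A → ℤ) → ∑ (map h xs) f ≡ ∑ xs (λ b → f (h b))
  ∑-map h []       f = refl
  ∑-map h (b ∷ xs) f = cong (f (h b) +_) (∑-map h xs f)

∑-comm : ∀ {A B : Set} (xs : List A) (ys : List B) (f : A → B → ℤ) →
  ∑ xs (λ a → ∑ ys (f a)) ≡ ∑ ys (λ b → ∑ xs (λ a → f a b))
∑-comm []       ys f = sym (∑-zero ys (λ _ → refl))
∑-comm (a ∷ xs) ys f =
  trans (cong (∑ ys (f a) +_) (∑-comm xs ys f)) (sym (∑-+ ys (f a) (λ b → ∑ xs (λ a → f a b))))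

∑ₛ : ∀ n → (Subset n → ℤ) → ℤ
∑ₛ n = ∑ (allSubsets n)

∑ₛ-suc : ∀ n (f : Subset (suc n) → ℤ) →
  ∑ₛ (suc n) f ≡ ∑ₛ n (λ U → f (outside ∷ U)) + ∑ₛ n (λ U → f (inside ∷ U))
∑ₛ-suc n f = trans (∑-++ (map (outside ∷_) (allSubsets n)) _ f)
  (cong₂ _+_ (∑-map (outside ∷_) (allSubsets n) f) (∑-map (inside ∷_) (allSubsets n) f))

∑ₛ-suc² : ∀ n (H : Subset (suc n) → Subset (suc n) → ℤ) →
  ∑ₛ (suc n) (λ M → ∑ₛ (suc n) (H M))
    ≡ (∑ₛ n (λ M → ∑ₛ n (λ S → H (outside ∷ M) (outside ∷ S)))
        + ∑ₛ n (λ M → ∑ₛ n (λ S → H (outside ∷ M) (inside ∷ S))))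
      + (∑ₛ n (λ M → ∑ₛ n (λ S → H (inside ∷ M) (outside ∷ S)))
        + ∑ₛ n (λ M → ∑ₛ n (λ S → H (inside ∷ M) (inside ∷ S))))
∑ₛ-suc² n H = trans (∑ₛ-suc n _) (cong₂ _+_ (inner outside) (inner inside))
  where
  inner : ∀ s → ∑ₛ n (λ M → ∑ₛ (suc n) (H (s ∷ M)))
              ≡ ∑ₛ n (λ M → ∑ₛ n (λ S → H (s ∷ M) (outside ∷ S)))
                + ∑ₛ n (λ M → ∑ₛ n (λ S → H (s ∷ M) (inside ∷ S)))
  inner s = trans (∑-cong (allSubsets n) (λ M → ∑ₛ-suc n (H (s ∷ M)))) (∑-+ (allSubsets n) _ _)

∑ₛ-δ : ∀ n (B : Subset n) (f : Subset n → ℤ) → ∑ₛ n (λ A → 𝟙[ does (B ≟ₛ A) ] (f A)) ≡ f B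
∑ₛ-δ zero    []            f = ℤ.+-identityʳ (f [])
∑ₛ-δ (suc n) (outside ∷ B) f = begin
  _  ≡⟨ ∑ₛ-suc n _ ⟩
  _  ≡⟨ cong₂ _+_ (∑ₛ-δ n B (λ A → f (outside ∷ A))) (∑-zero (allSubsets n) (λ _ → refl)) ⟩
  _  ≡⟨ ℤ.+-identityʳ _ ⟩
  _  ∎
  where open ≡-Reasoning
∑ₛ-δ (suc n) (inside ∷ B)  f = begin
  _  ≡⟨ ∑ₛ-suc n _ ⟩
  _  ≡⟨ cong₂ _+_ (∑-zero (allSubsets n) (λ _ → refl)) (∑ₛ-δ n B (λ A → f (inside ∷ A))) ⟩
  _  ≡⟨ ℤ.+-identityˡ _ ⟩
  _  ∎
  where open ≡-Reasoning

∑ₛ-fibres : ∀ n (k : Subset n → Subset n) (h : Subset n → Subset n → ℤ) →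
  ∑ₛ n (λ A → ∑ₛ n (λ M → 𝟙[ does (k M ≟ₛ A) ] (h M A))) ≡ ∑ₛ n (λ M → h M (k M))
∑ₛ-fibres n k h = trans (∑-comm (allSubsets n) (allSubsets n) _)
  (∑-cong (allSubsets n) (λ M → ∑ₛ-δ n (k M) (h M)))

private
  summand : ∀ {n} → Subset n → (Subset n → ℤ) → Subset n → Subset n → ℤ
  summand C F M S = 𝟙[ does (M ⊆? ∁ C) ] (𝟙[ does (S ⊆? C) ] (F (M ∪ S)))

  parts : ∀ {n} → Subset n → (Subset n → ℤ) → ℤ
  parts {n} C F = ∑ₛ n (λ M → ∑ₛ n (summand C F M))

-- Every subset is uniquely M ∪ S with M ⊆ ∁ C and S ⊆ C.
∑ₛ-split : ∀ n (C : Subset n) (F : Subset n → ℤ) →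
  ∑ₛ n F ≡ ∑ₛ n (λ M → ∑ₛ n (λ S → 𝟙[ does (M ⊆? ∁ C) ] (𝟙[ does (S ⊆? C) ] (F (M ∪ S)))))
∑ₛ-split zero    []            F = sym (ℤ.+-identityʳ _)
∑ₛ-split (suc n) (inside ∷ C)  F = begin
  ∑ₛ (suc n) F                          ≡⟨ ∑ₛ-suc n F ⟩
  ∑ₛ n Fₒ + ∑ₛ n Fᵢ                     ≡⟨ cong₂ _+_ (∑ₛ-split n C Fₒ) (∑ₛ-split n C Fᵢ) ⟩
  parts C Fₒ + parts C Fᵢ               ≡⟨ sym (ℤ.+-identityʳ _) ⟩
  parts C Fₒ + parts C Fᵢ + (0ℤ + 0ℤ)   ≡⟨ cong (parts C Fₒ + parts C Fᵢ +_)
                                              (sym (cong₂ _+_ vanish vanish)) ⟩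
  _                                     ≡⟨ sym (∑ₛ-suc² n (λ M S → summand (inside ∷ C) F M S)) ⟩
  parts (inside ∷ C) F                  ∎
  where
  open ≡-Reasoning
  Fₒ Fᵢ : Subset n → ℤ
  Fₒ U = F (outside ∷ U)
  Fᵢ U = F (inside ∷ U)
  vanish : ∑ₛ n (λ M → ∑ₛ n (λ S → 0ℤ)) ≡ 0ℤ
  vanish = ∑-zero (allSubsets n) (λ M → ∑-zero (allSubsets n) (λ S → refl))
∑ₛ-split (suc n) (outside ∷ C) F = begin
  ∑ₛ (suc n) F                          ≡⟨ ∑ₛ-suc n F ⟩
  ∑ₛ n Fₒ + ∑ₛ n Fᵢ                     ≡⟨ cong₂ _+_ (∑ₛ-split n C Fₒ) (∑ₛ-split n C Fᵢ) ⟩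
  parts C Fₒ + parts C Fᵢ               ≡⟨ cong₂ _+_ (sym (ℤ.+-identityʳ (parts C Fₒ)))
                                                     (sym (ℤ.+-identityʳ (parts C Fᵢ))) ⟩
  (parts C Fₒ + 0ℤ) + (parts C Fᵢ + 0ℤ) ≡⟨ cong₂ _+_ (cong (parts C Fₒ +_) (sym vanish))
                                                     (cong (parts C Fᵢ +_) (sym vanish)) ⟩
  _                                     ≡⟨ sym (∑ₛ-suc² n (λ M S → summand (outside ∷ C) F M S)) ⟩
  parts (outside ∷ C) F                 ∎
  where
  open ≡-Reasoning
  Fₒ Fᵢ : Subset n → ℤ
  Fₒ U = F (outside ∷ U)
  Fᵢ U = F (inside ∷ U)
  vanish : ∑ₛ n (λ M → ∑ₛ n (λ S → 𝟙[ does (M ⊆? ∁ C) ] 0ℤ)) ≡ 0ℤ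
  vanish = ∑-zero (allSubsets n) (λ M → ∑-zero (allSubsets n) (λ S → 𝟙-0 (does (M ⊆? ∁ C))))

∑ₛ-interval : ∀ n (A C : Subset n) → A ⊆ C → (x : ℤ) →
  ∑ₛ n (λ S → 𝟙[ does (S ⊆? C) ] (𝟙[ does (A ⊆? S) ] (x ^ ∣ S ∣)))
    ≡ x ^ ∣ A ∣ * (1ℤ + x) ^ (∣ C ∣ ∸ ∣ A ∣)
∑ₛ-interval zero    []            []            A⊆C x = refl
∑ₛ-interval (suc n) (inside ∷ A)  (outside ∷ C) A⊆C x with A⊆C here
... | ()
∑ₛ-interval (suc n) (outside ∷ A) (outside ∷ C) A⊆C x = begin
  _      ≡⟨ ∑ₛ-suc n _ ⟩
  _      ≡⟨ cong₂ _+_ (∑ₛ-interval n A C (drop-∷-⊆ A⊆C) x) (∑-zero (allSubsets n) (λ _ → refl)) ⟩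
  _      ≡⟨ ℤ.+-identityʳ _ ⟩
  _      ∎
  where open ≡-Reasoning
∑ₛ-interval (suc n) (outside ∷ A) (inside ∷ C)  A⊆C x = begin
  ∑ₛ (suc n) _               ≡⟨ ∑ₛ-suc n _ ⟩
  y + ∑ₛ n (λ S → 𝟙[ does (S ⊆? C) ] (𝟙[ does (A ⊆? S) ] (x * x ^ ∣ S ∣)))
                             ≡⟨ cong (y +_) (∑-𝟙²-*ˡ (allSubsets n) x (λ S → does (S ⊆? C))
                                                      (λ S → does (A ⊆? S)) (λ S → x ^ ∣ S ∣)) ⟩
  y + x * y                  ≡⟨ cong (λ t → t + x * t) (∑ₛ-interval n A C (drop-∷-⊆ A⊆C) x) ⟩
  z + x * z                  ≡⟨ factor (x ^ ∣ A ∣) ((1ℤ + x) ^ (∣ C ∣ ∸ ∣ A ∣)) x ⟩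
  x ^ ∣ A ∣ * (1ℤ + x) ^ suc (∣ C ∣ ∸ ∣ A ∣)
                             ≡⟨ cong (λ k → x ^ ∣ A ∣ * (1ℤ + x) ^ k)
                                     (sym (ℕ.+-∸-assoc 1 (p⊆q⇒∣p∣≤∣q∣ (drop-∷-⊆ A⊆C)))) ⟩
  x ^ ∣ A ∣ * (1ℤ + x) ^ (suc ∣ C ∣ ∸ ∣ A ∣) ∎
  where
  open ≡-Reasoning
  y = ∑ₛ n (λ S → 𝟙[ does (S ⊆? C) ] (𝟙[ does (A ⊆? S) ] (x ^ ∣ S ∣)))
  z = x ^ ∣ A ∣ * (1ℤ + x) ^ (∣ C ∣ ∸ ∣ A ∣)
  factor : ∀ a b x → a * b + x * (a * b) ≡ a * ((1ℤ + x) * b)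
  factor = solve-∀
∑ₛ-interval (suc n) (inside ∷ A)  (inside ∷ C)  A⊆C x = begin
  ∑ₛ (suc n) _               ≡⟨ ∑ₛ-suc n _ ⟩
  ∑ₛ n (λ S → 𝟙[ does (S ⊆? C) ] 0ℤ)
    + ∑ₛ n (λ S → 𝟙[ does (S ⊆? C) ] (𝟙[ does (A ⊆? S) ] (x * x ^ ∣ S ∣)))
                             ≡⟨ cong₂ _+_ (∑-zero (allSubsets n) (λ S → 𝟙-0 (does (S ⊆? C))))
                                          (∑-𝟙²-*ˡ (allSubsets n) x (λ S → does (S ⊆? C))
                                                   (λ S → does (A ⊆? S)) (λ S → x ^ ∣ S ∣)) ⟩
  0ℤ + x * y                 ≡⟨ ℤ.+-identityˡ (x * y) ⟩
  x * y                      ≡⟨ cong (x *_) (∑ₛ-interval n A C (drop-∷-⊆ A⊆C) x) ⟩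
  x * (x ^ ∣ A ∣ * (1ℤ + x) ^ (∣ C ∣ ∸ ∣ A ∣))
                             ≡⟨ sym (ℤ.*-assoc x (x ^ ∣ A ∣) _) ⟩
  x * x ^ ∣ A ∣ * (1ℤ + x) ^ (∣ C ∣ ∸ ∣ A ∣) ∎
  where
  open ≡-Reasoning
  y = ∑ₛ n (λ S → 𝟙[ does (S ⊆? C) ] (𝟙[ does (A ⊆? S) ] (x ^ ∣ S ∣)))

nonSupersetPoly : ∀ {n} → Subset n → Subset n → ℤ → ℤ
nonSupersetPoly C A x = (1ℤ + x) ^ ∣ C ∣ - x ^ ∣ A ∣ * (1ℤ + x) ^ (∣ C ∣ ∸ ∣ A ∣)

nonSupersetPoly≡∑ : ∀ n (A C : Subset n) → A ⊆ C → (x : ℤ) →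
  nonSupersetPoly C A x ≡ ∑ₛ n (λ S → 𝟙[ does (S ⊆? C) ] (𝟙[ not (does (A ⊆? S)) ] (x ^ ∣ S ∣)))
nonSupersetPoly≡∑ n A C A⊆C x = begin
  nonSupersetPoly C A x
    ≡⟨ cong₂ _-_ (sym all) (sym (∑ₛ-interval n A C A⊆C x)) ⟩
  ∑ₛ n (λ S → 𝟙[ does (S ⊆? C) ] (𝟙[ does (⊥ ⊆? S) ] (x ^ ∣ S ∣)))
    - ∑ₛ n (λ S → 𝟙[ does (S ⊆? C) ] (𝟙[ does (A ⊆? S) ] (x ^ ∣ S ∣)))
    ≡⟨ sym (∑-- (allSubsets n) _ _) ⟩
  _ ≡⟨ ∑-cong (allSubsets n) difference ⟩
  _ ∎
  where
  open ≡-Reasoning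
  all : ∑ₛ n (λ S → 𝟙[ does (S ⊆? C) ] (𝟙[ does (⊥ ⊆? S) ] (x ^ ∣ S ∣))) ≡ (1ℤ + x) ^ ∣ C ∣
  all = trans (∑ₛ-interval n ⊥ C ⊥⊆ x)
    (trans (cong (λ k → x ^ k * (1ℤ + x) ^ (∣ C ∣ ∸ k)) (∣⊥∣≡0 n)) (ℤ.*-identityˡ _))
  𝟙-difference : ∀ b c v → 𝟙[ b ] (𝟙[ true ] v) - 𝟙[ b ] (𝟙[ c ] v) ≡ 𝟙[ b ] (𝟙[ not c ] v)
  𝟙-difference true  true  v = ℤ.+-inverseʳ v
  𝟙-difference true  false v = ℤ.+-identityʳ v
  𝟙-difference false c     v = refl
  difference : ∀ S → 𝟙[ does (S ⊆? C) ] (𝟙[ does (⊥ ⊆? S) ] (x ^ ∣ S ∣))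
                     - 𝟙[ does (S ⊆? C) ] (𝟙[ does (A ⊆? S) ] (x ^ ∣ S ∣))
                   ≡ 𝟙[ does (S ⊆? C) ] (𝟙[ not (does (A ⊆? S)) ] (x ^ ∣ S ∣))
  difference S rewrite dec-true (⊥ ⊆? S) ⊥⊆ = 𝟙-difference (does (S ⊆? C)) (does (A ⊆? S)) (x ^ ∣ S ∣)

nonSupersetPoly-⊥ : ∀ {n} (C : Subset n) (x : ℤ) → nonSupersetPoly C ⊥ x ≡ 0ℤ
nonSupersetPoly-⊥ {n} C x rewrite ∣⊥∣≡0 n =
  trans (cong (λ t → (1ℤ + x) ^ ∣ C ∣ - t) (ℤ.*-identityˡ _)) (ℤ.+-inverseʳ ((1ℤ + x) ^ ∣ C ∣))

∈-allSubsets : ∀ n (M : Subset n) → M ∈ₗ allSubsets n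
∈-allSubsets zero    []            = Any.here refl
∈-allSubsets (suc n) (outside ∷ M) = ∈-++⁺ˡ (∈-map⁺ (outside ∷_) (∈-allSubsets n M))
∈-allSubsets (suc n) (inside ∷ M)  =
  ∈-++⁺ʳ (map (outside ∷_) (allSubsets n)) (∈-map⁺ (inside ∷_) (∈-allSubsets n M))

∈-tabulate⁺ : ∀ {n} {f : Fin n → Bool} {u} → f u ≡ true → u ∈ tabulate f
∈-tabulate⁺ {f = f} {u} fu = lookup⇒[]= u (tabulate f) (trans (lookup∘tabulate f u) fu)

∈-tabulate⁻ : ∀ {n} {f : Fin n → Bool} {u} → u ∈ tabulate f → f u ≡ true
∈-tabulate⁻ {f = f} {u} u∈ = trans (sym (lookup∘tabulate f u)) ([]=⇒lookup u∈)

x∈p─q⁺ : ∀ {n} (p q : Subset n) {u} → u ∈ p → u ∉ q → u ∈ p ─ q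
x∈p─q⁺ (inside ∷ p) (outside ∷ q) here      u∉q = here
x∈p─q⁺ (inside ∷ p) (inside ∷ q)  here      u∉q = contradiction here u∉q
x∈p─q⁺ (_ ∷ p)      (outside ∷ q) (there u) u∉q = there (x∈p─q⁺ p q u (λ k → u∉q (there k)))
x∈p─q⁺ (_ ∷ p)      (inside ∷ q)  (there u) u∉q = there (x∈p─q⁺ p q u (λ k → u∉q (there k)))

x∈p─q⇒x∉q : ∀ {n} (p q : Subset n) {u} → u ∈ p ─ q → u ∉ q
x∈p─q⇒x∉q (_ ∷ p) (outside ∷ q) here      ()
x∈p─q⇒x∉q (_ ∷ p) (_ ∷ q)       (there u) (there k) = x∈p─q⇒x∉q p q u k

⊈⇒∃∈∉ : ∀ {n} (p q : Subset n) → ¬ p ⊆ q → ∃ λ u → u ∈ p × u ∉ q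
⊈⇒∃∈∉ p q p⊈q with any? (λ u → u ∈? p ×-dec ¬? (u ∈? q))
... | yes witness = witness
... | no  ¬∃      =
  contradiction (λ {u} u∈p → decidable-stable (u ∈? q) (λ u∉q → ¬∃ (u , u∈p , u∉q))) p⊈q

∣p∪q∣≡∣p∣+∣q∣ : ∀ {n} (p q : Subset n) → (∀ {u} → u ∈ p → u ∉ q) → ∣ p ∪ q ∣ ≡ ∣ p ∣ ℕ.+ ∣ q ∣
∣p∪q∣≡∣p∣+∣q∣ []            []            disj = refl
∣p∪q∣≡∣p∣+∣q∣ (inside ∷ p)  (inside ∷ q)  disj = contradiction here (disj here)
∣p∪q∣≡∣p∣+∣q∣ (inside ∷ p)  (outside ∷ q) disj =
  cong suc (∣p∪q∣≡∣p∣+∣q∣ p q (λ u∈p u∈q → disj (there u∈p) (there u∈q)))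
∣p∪q∣≡∣p∣+∣q∣ (outside ∷ p) (inside ∷ q)  disj =
  trans (cong suc (∣p∪q∣≡∣p∣+∣q∣ p q (λ u∈p u∈q → disj (there u∈p) (there u∈q))))
        (sym (ℕ.+-suc ∣ p ∣ ∣ q ∣))
∣p∪q∣≡∣p∣+∣q∣ (outside ∷ p) (outside ∷ q) disj =
  ∣p∪q∣≡∣p∣+∣q∣ p q (λ u∈p u∈q → disj (there u∈p) (there u∈q))

module _ {n : ℕ} (G : Graph n) where

  ∈Nbh⇒adj : ∀ {w u} → u ∈ Nbh G w → adj G w u ≡ true
  ∈Nbh⇒adj = ∈-tabulate⁻

  adj⇒∈Nbh : ∀ {w u} → adj G w u ≡ true → u ∈ Nbh G w
  adj⇒∈Nbh = ∈-tabulate⁺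

  ∈Nbh-sym : ∀ {w u} → u ∈ Nbh G w → w ∈ Nbh G u
  ∈Nbh-sym {w} {u} u∈ = adj⇒∈Nbh (trans (Graph.sym G u w) (∈Nbh⇒adj u∈))

  ∉Nbh-self : ∀ {u} → u ∉ Nbh G u
  ∉Nbh-self {u} u∈ with trans (sym (irrefl G u)) (∈Nbh⇒adj u∈)
  ... | ()

  ∈Ncap⁻ : ∀ {W u w} → u ∈ Ncap G W → w ∈ W → u ∈ Nbh G w
  ∈Ncap⁻ {W} {u} u∈ = dec-true⁻ (all? λ w → w ∈? W →-dec u ∈? Nbh G w) (∈-tabulate⁻ u∈) _

  ∈Ncap⁺ : ∀ {W u} → (∀ w → w ∈ W → u ∈ Nbh G w) → u ∈ Ncap G W
  ∈Ncap⁺ {W} {u} h = ∈-tabulate⁺ (dec-true (all? λ w → w ∈? W →-dec u ∈? Nbh G w) h)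

  ∈Ncup⁺ : ∀ {W u w} → w ∈ W → u ∈ Nbh G w → u ∈ Ncup G W
  ∈Ncup⁺ {W} {u} {w} w∈W u∈ =
    ∈-tabulate⁺ (dec-true (any? λ w → w ∈? W ×-dec u ∈? Nbh G w) (w , w∈W , u∈))

  clique⇒∈Nbh : ∀ {C u w} → IsClique G C → u ∈ C → w ∈ C → u ≢ w → w ∈ Nbh G u
  clique⇒∈Nbh cl u∈C w∈C u≢w = adj⇒∈Nbh (cl _ _ u∈C w∈C u≢w)

  clique-extend : ∀ {C w} → IsClique G C → C ⊆ Nbh G w → IsClique G (C ∪ ⁅ w ⁆)
  clique-extend {C} {w} cl C⊆N u v u∈ v∈ u≢v with x∈p∪q⁻ C ⁅ w ⁆ u∈ | x∈p∪q⁻ C ⁅ w ⁆ v∈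
  ... | inj₁ u∈C | inj₁ v∈C = cl u v u∈C v∈C u≢v
  ... | inj₁ u∈C | inj₂ v≡w rewrite x∈⁅y⁆⇒x≡y w v≡w = trans (Graph.sym G u w) (∈Nbh⇒adj (C⊆N u∈C))
  ... | inj₂ u≡w | inj₁ v∈C rewrite x∈⁅y⁆⇒x≡y w u≡w = ∈Nbh⇒adj (C⊆N v∈C)
  ... | inj₂ u≡w | inj₂ v≡w = contradiction (trans (x∈⁅y⁆⇒x≡y w u≡w) (sym (x∈⁅y⁆⇒x≡y w v≡w))) u≢v

  maximalClique⇒∉NbhComplex : ∀ {C} → IsMaximalClique G C → ¬ InNbhComplex G C
  maximalClique⇒∉NbhComplex {C} (cl , maximal) (w , C⊆N) = ∉Nbh-self (C⊆N w∈C)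
    where
    w∈C : w ∈ C
    w∈C = maximal (C ∪ ⁅ w ⁆) (clique-extend cl C⊆N)
                  (λ u∈C → x∈p∪q⁺ (inj₁ u∈C)) (x∈p∪q⁺ (inj₂ (x∈⁅x⁆ w)))

  ¬maximalClique⇒∈NbhComplex : ∀ {C} → IsClique G C → ¬ IsMaximalClique G C → InNbhComplex G C
  ¬maximalClique⇒∈NbhComplex {C} cl ¬maximal with inNbhComplex? G C
  ... | yes C∈𝒩 = C∈𝒩
  ... | no  C∉𝒩 = contradiction (cl , maximal) ¬maximal
    where
    maximal : ∀ D → IsClique G D → C ⊆ D → D ⊆ C
    maximal D clD C⊆D {u} u∈D = decidable-stable (u ∈? C) λ u∉C →
      C∉𝒩 (u , λ {c} c∈C → clique⇒∈Nbh clD u∈D (C⊆D c∈C) (λ { refl → u∉C c∈C }))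

  periphery⊆∁ : ∀ C → periphery G C ⊆ ∁ C
  periphery⊆∁ C u∈P = x∉p⇒x∈∁p (x∈p─q⇒x∉q (Ncup G C) C u∈P)

  anchor⊆ : ∀ M C → anchor G M C ⊆ C
  anchor⊆ M C u∈A = proj₂ (x∈p∩q⁻ (Ncap G M) C u∈A)

-- Adding a vertex joined to a clique

module AddVertex {n : ℕ} (G : Graph n) (C : Subset n) (clique : IsClique G C) where

  G⁺ : Graph (suc n)
  G⁺ = addVertex G C

  ∈Nbh⁺-new⁻ : ∀ {u} → suc u ∈ Nbh G⁺ zero → u ∈ C
  ∈Nbh⁺-new⁻ {u} u∈ = dec-true⁻ (u ∈? C) (∈Nbh⇒adj G⁺ {zero} {suc u} u∈)

  ∈Nbh⁺-new⁺ : ∀ {u} → u ∈ C → suc u ∈ Nbh G⁺ zero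
  ∈Nbh⁺-new⁺ {u} u∈C = adj⇒∈Nbh G⁺ {zero} {suc u} (dec-true (u ∈? C) u∈C)

  ∈Nbh⁺-old⁻ : ∀ {w u} → suc u ∈ Nbh G⁺ (suc w) → u ∈ Nbh G w
  ∈Nbh⁺-old⁻ {w} {u} u∈ = adj⇒∈Nbh G (∈Nbh⇒adj G⁺ {suc w} {suc u} u∈)

  ∈Nbh⁺-old⁺ : ∀ {w u} → u ∈ Nbh G w → suc u ∈ Nbh G⁺ (suc w)
  ∈Nbh⁺-old⁺ {w} {u} u∈ = adj⇒∈Nbh G⁺ {suc w} {suc u} (∈Nbh⇒adj G u∈)

  lift-face : ∀ {U} → InNbhComplex G U → InNbhComplex G⁺ (outside ∷ U)
  lift-face (w , U⊆N) = suc w , λ { (there u∈U) → ∈Nbh⁺-old⁺ (U⊆N u∈U) }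

  C-face : InNbhComplex G⁺ (outside ∷ C)
  C-face = zero , λ { (there u∈C) → ∈Nbh⁺-new⁺ u∈C }

  ⊆Nbh⁺-new⇒⊆C : ∀ {U} → outside ∷ U ⊆ Nbh G⁺ zero → U ⊆ C
  ⊆Nbh⁺-new⇒⊆C U⊆N u∈U = ∈Nbh⁺-new⁻ (U⊆N (there u∈U))

  lower-face : ∀ {U} → C ≢ U → InNbhComplex G⁺ (outside ∷ U) → InNbhComplex G U
  lower-face C≢U (suc w , U⊆N) = w , λ u∈U → ∈Nbh⁺-old⁻ (U⊆N (there u∈U))
  lower-face {U} C≢U (zero , U⊆N)
    with ⊈⇒∃∈∉ C U (λ C⊆U → C≢U (⊆-antisym C⊆U (⊆Nbh⁺-new⇒⊆C U⊆N)))
  ... | c , c∈C , c∉U =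
    c , λ u∈U → clique⇒∈Nbh G clique c∈C (⊆Nbh⁺-new⇒⊆C U⊆N u∈U) (λ { refl → c∉U u∈U })

  face-avoiding-term : (maxDec : Dec (IsMaximalClique G C)) (x : ℤ) (U : Subset n) →
    𝟙[ does (inNbhComplex? G⁺ (outside ∷ U)) ] (x ^ ∣ U ∣)
      ≡ 𝟙[ does (inNbhComplex? G U) ] (x ^ ∣ U ∣) + 𝟙[ does (C ≟ₛ U) ] (φ G C maxDec x)
  face-avoiding-term maxDec x U with C ≟ₛ U
  face-avoiding-term maxDec x U | no C≢U
    rewrite does-⇔ (mk⇔ (lower-face C≢U) lift-face) (inNbhComplex? G⁺ (outside ∷ U)) (inNbhComplex? G U)
    = sym (ℤ.+-identityʳ _)
  face-avoiding-term (yes maximal) x U | yes refl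
    rewrite dec-true (inNbhComplex? G⁺ (outside ∷ C)) C-face
          | dec-false (inNbhComplex? G C) (maximalClique⇒∉NbhComplex G maximal)
    = sym (ℤ.+-identityˡ _)
  face-avoiding-term (no ¬maximal) x U | yes refl
    rewrite dec-true (inNbhComplex? G⁺ (outside ∷ C)) C-face
          | dec-true (inNbhComplex? G C) (¬maximalClique⇒∈NbhComplex G clique ¬maximal)
    = sym (ℤ.+-identityʳ _)

  ∑-faces-avoiding : (maxDec : Dec (IsMaximalClique G C)) (x : ℤ) →
    ∑ₛ n (λ U → 𝟙[ does (inNbhComplex? G⁺ (outside ∷ U)) ] (x ^ ∣ U ∣)) ≡ nbhPoly G x + φ G C maxDec x
  ∑-faces-avoiding maxDec x = begin
    _ ≡⟨ ∑-cong (allSubsets n) (face-avoiding-term maxDec x) ⟩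
    _ ≡⟨ ∑-+ (allSubsets n) _ _ ⟩
    _ ≡⟨ cong₂ _+_ (sym (∑-filter (inNbhComplex? G) (λ U → x ^ ∣ U ∣) (allSubsets n)))
                   (∑ₛ-δ n C (λ _ → φ G C maxDec x)) ⟩
    _ ∎
    where open ≡-Reasoning

  new-face⇔ : ∀ {W} → InNbhComplex G⁺ (inside ∷ W) ⇔ (∃ λ u → u ∈ C × W ⊆ Nbh G u)
  new-face⇔ {W} = mk⇔ to from
    where
    to : InNbhComplex G⁺ (inside ∷ W) → ∃ λ u → u ∈ C × W ⊆ Nbh G u
    to (zero  , W⊆N) = contradiction (W⊆N here) (∉Nbh-self G⁺)
    to (suc u , W⊆N) = u , ∈Nbh⁺-new⁻ (∈Nbh-sym G⁺ (W⊆N here)) , λ w∈W → ∈Nbh⁺-old⁻ (W⊆N (there w∈W))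
    from : (∃ λ u → u ∈ C × W ⊆ Nbh G u) → InNbhComplex G⁺ (inside ∷ W)
    from (u , u∈C , W⊆N) =
      suc u , λ { here → ∈Nbh-sym G⁺ (∈Nbh⁺-new⁺ u∈C) ; (there w∈W) → ∈Nbh⁺-old⁺ (W⊆N w∈W) }

  anchor-criterion : ∀ {M S} → M ⊆ ∁ C → S ⊆ C →
    (∃ λ u → u ∈ C × M ∪ S ⊆ Nbh G u) ⇔ (M ⊆ periphery G C × ¬ anchor G M C ⊆ S)
  anchor-criterion {M} {S} M⊆∁C S⊆C = mk⇔ to from
    where
    to : (∃ λ u → u ∈ C × M ∪ S ⊆ Nbh G u) → M ⊆ periphery G C × ¬ anchor G M C ⊆ S
    to (u , u∈C , M∪S⊆N) = M⊆P , λ A⊆S → ∉Nbh-self G (M∪S⊆N (x∈p∪q⁺ (inj₂ (A⊆S u∈A))))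
      where
      M⊆N : M ⊆ Nbh G u
      M⊆N w∈M = M∪S⊆N (x∈p∪q⁺ (inj₁ w∈M))
      M⊆P : M ⊆ periphery G C
      M⊆P w∈M = x∈p─q⁺ (Ncup G C) C (∈Ncup⁺ G u∈C (M⊆N w∈M)) (x∈∁p⇒x∉p (M⊆∁C w∈M))
      u∈A : u ∈ anchor G M C
      u∈A = x∈p∩q⁺ (∈Ncap⁺ G (λ w w∈M → ∈Nbh-sym G (M⊆N w∈M)) , u∈C)
    from : M ⊆ periphery G C × ¬ anchor G M C ⊆ S → ∃ λ u → u ∈ C × M ∪ S ⊆ Nbh G u
    from (_ , A⊈S) with ⊈⇒∃∈∉ (anchor G M C) S A⊈S
    ... | u , u∈A , u∉S = u , anchor⊆ G M C u∈A , M∪S⊆N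
      where
      M∪S⊆N : M ∪ S ⊆ Nbh G u
      M∪S⊆N w∈ with x∈p∪q⁻ M S w∈
      ... | inj₁ w∈M = ∈Nbh-sym G (∈Ncap⁻ G (proj₁ (x∈p∩q⁻ (Ncap G M) C u∈A)) w∈M)
      ... | inj₂ w∈S = clique⇒∈Nbh G clique (anchor⊆ G M C u∈A) (S⊆C w∈S) (λ { refl → u∉S w∈S })

  face-containing-term : ∀ x M S →
    𝟙[ does (M ⊆? ∁ C) ] (𝟙[ does (S ⊆? C) ]
      (𝟙[ does (inNbhComplex? G⁺ (inside ∷ (M ∪ S))) ] (x ^ ∣ inside ∷ (M ∪ S) ∣)))
      ≡ x * 𝟙[ does (M ⊆? periphery G C) ]
              (x ^ ∣ M ∣ * 𝟙[ does (S ⊆? C) ] (𝟙[ not (does (anchor G M C ⊆? S)) ] (x ^ ∣ S ∣)))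
  face-containing-term x M S with M ⊆? ∁ C | S ⊆? C
  ... | no M⊈∁C | _
    rewrite dec-false (M ⊆? periphery G C) (λ M⊆P → M⊈∁C (λ w∈M → periphery⊆∁ G C (M⊆P w∈M)))
    = sym (ℤ.*-zeroʳ x)
  ... | yes _ | no _ = sym (begin
    x * 𝟙[ b ] (x ^ ∣ M ∣ * 0ℤ) ≡⟨ cong (λ t → x * 𝟙[ b ] t) (ℤ.*-zeroʳ (x ^ ∣ M ∣)) ⟩
    x * 𝟙[ b ] 0ℤ               ≡⟨ cong (x *_) (𝟙-0 b) ⟩
    x * 0ℤ                      ≡⟨ ℤ.*-zeroʳ x ⟩
    0ℤ                          ∎)
    where
    open ≡-Reasoning
    b = does (M ⊆? periphery G C)
  ... | yes M⊆∁C | yes S⊆C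
    rewrite does-⇔ (⇔-trans new-face⇔ (anchor-criterion M⊆∁C S⊆C))
                   (inNbhComplex? G⁺ (inside ∷ (M ∪ S)))
                   ((M ⊆? periphery G C) ×-dec ¬? (anchor G M C ⊆? S))
          | ∣p∪q∣≡∣p∣+∣q∣ M S (λ w∈M w∈S → x∈∁p⇒x∉p (M⊆∁C w∈M) (S⊆C w∈S))
    = by-cases (does (M ⊆? periphery G C)) (does (anchor G M C ⊆? S))
    where
    by-cases : ∀ a b → 𝟙[ a ∧ not b ] (x * x ^ (∣ M ∣ ℕ.+ ∣ S ∣))
                        ≡ x * 𝟙[ a ] (x ^ ∣ M ∣ * 𝟙[ not b ] (x ^ ∣ S ∣))
    by-cases true  false = cong (x *_) (ℤ.^-distribˡ-+-* x ∣ M ∣ ∣ S ∣)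
    by-cases true  true  = sym (trans (cong (x *_) (ℤ.*-zeroʳ (x ^ ∣ M ∣))) (ℤ.*-zeroʳ x))
    by-cases false b     = sym (ℤ.*-zeroʳ x)

  ∑-faces-containing : ∀ x →
    ∑ₛ n (λ W → 𝟙[ does (inNbhComplex? G⁺ (inside ∷ W)) ] (x ^ ∣ inside ∷ W ∣))
      ≡ x * ∑ₛ n (λ M → 𝟙[ does (M ⊆? periphery G C) ] (x ^ ∣ M ∣ * nonSupersetPoly C (anchor G M C) x))
  ∑-faces-containing x = begin
    _ ≡⟨ ∑ₛ-split n C _ ⟩
    _ ≡⟨ ∑-cong (allSubsets n) (λ M → ∑-cong (allSubsets n) (face-containing-term x M)) ⟩
    _ ≡⟨ ∑-cong (allSubsets n) sum-over-S ⟩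
    _ ≡⟨ ∑-*ˡ (allSubsets n) x _ ⟩
    _ ∎
    where
    open ≡-Reasoning
    sum-over-S : ∀ M →
      ∑ₛ n (λ S → x * 𝟙[ does (M ⊆? periphery G C) ]
                        (x ^ ∣ M ∣ * 𝟙[ does (S ⊆? C) ] (𝟙[ not (does (anchor G M C ⊆? S)) ] (x ^ ∣ S ∣))))
        ≡ x * 𝟙[ does (M ⊆? periphery G C) ] (x ^ ∣ M ∣ * nonSupersetPoly C (anchor G M C) x)
    sum-over-S M = begin
      _ ≡⟨ ∑-*ˡ (allSubsets n) x _ ⟩
      _ ≡⟨ cong (x *_) (∑-𝟙 (allSubsets n) (does (M ⊆? periphery G C)) _) ⟩
      _ ≡⟨ cong (λ t → x * 𝟙[ does (M ⊆? periphery G C) ] t) (∑-*ˡ (allSubsets n) (x ^ ∣ M ∣) _) ⟩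
      _ ≡⟨ cong (λ t → x * 𝟙[ does (M ⊆? periphery G C) ] (x ^ ∣ M ∣ * t))
                (sym (nonSupersetPoly≡∑ n (anchor G M C) C (anchor⊆ G M C) x)) ⟩
      _ ∎

  periphPoly-expand : ∀ x A → periphPoly G A C x * nonSupersetPoly C A x
    ≡ ∑ₛ n (λ M → 𝟙[ does (inPeriphSets? G A C M) ] (x ^ ∣ M ∣ * nonSupersetPoly C A x))
  periphPoly-expand x A = begin
    _ ≡⟨ cong (_* nonSupersetPoly C A x)
              (∑-filter (inPeriphSets? G A C) (λ M → x ^ ∣ M ∣) (allSubsets n)) ⟩
    _ ≡⟨ sym (∑-*ʳ (allSubsets n) (nonSupersetPoly C A x) _) ⟩
    _ ≡⟨ ∑-cong (allSubsets n) (λ M → 𝟙-*ʳ (does (inPeriphSets? G A C M)) (x ^ ∣ M ∣) _) ⟩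
    _ ∎
    where open ≡-Reasoning

  -- The anchor set of M lies in 𝒜_G(C) unless it is empty, and then its weight vanishes.
  anchors-drop : ∀ x A M →
    𝟙[ does (inAnchors? G C A) ] (𝟙[ does (inPeriphSets? G A C M) ] (x ^ ∣ M ∣ * nonSupersetPoly C A x))
      ≡ 𝟙[ does (inPeriphSets? G A C M) ] (x ^ ∣ M ∣ * nonSupersetPoly C A x)
  anchors-drop x A M with M ⊆? periphery G C | anchor G M C ≟ₛ A
  ... | no _    | _    = 𝟙-0 (does (inAnchors? G C A))
  ... | yes _   | no _ = 𝟙-0 (does (inAnchors? G C A))
  ... | yes M⊆P | yes refl = by-nonemptiness (nonempty? (anchor G M C))
    where
    ia = does (inAnchors? G C (anchor G M C))
    term = x ^ ∣ M ∣ * nonSupersetPoly C (anchor G M C) x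
    by-nonemptiness : Dec (Nonempty (anchor G M C)) → 𝟙[ ia ] term ≡ term
    by-nonemptiness (yes nonempty) =
      𝟙-true (inAnchors? G C (anchor G M C))
             (anchor⊆ G M C , nonempty , lose (∈-allSubsets n M) (M⊆P , refl)) term
    by-nonemptiness (no empty) = trans (cong 𝟙[ ia ]_ term≡0) (trans (𝟙-0 ia) (sym term≡0))
      where
      term≡0 : term ≡ 0ℤ
      term≡0 = trans (cong (λ A → x ^ ∣ M ∣ * nonSupersetPoly C A x) (Empty-unique empty))
                     (trans (cong (x ^ ∣ M ∣ *_) (nonSupersetPoly-⊥ C x)) (ℤ.*-zeroʳ (x ^ ∣ M ∣)))

  ∑-by-anchor : ∀ x →
    ∑ₛ n (λ M → 𝟙[ does (M ⊆? periphery G C) ] (x ^ ∣ M ∣ * nonSupersetPoly C (anchor G M C) x))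
      ≡ sumℤ (map (λ A → periphPoly G A C x * nonSupersetPoly C A x)
                  (filter (inAnchors? G C) (allSubsets n)))
  ∑-by-anchor x = sym (begin
    _ ≡⟨ ∑-filter (inAnchors? G C) _ (allSubsets n) ⟩
    _ ≡⟨ ∑-cong (allSubsets n) (λ A → cong 𝟙[ does (inAnchors? G C A) ]_ (periphPoly-expand x A)) ⟩
    _ ≡⟨ ∑-cong (allSubsets n) (λ A → sym (∑-𝟙 (allSubsets n) (does (inAnchors? G C A)) _)) ⟩
    _ ≡⟨ ∑-cong (allSubsets n) (λ A → ∑-cong (allSubsets n) (anchors-drop x A)) ⟩
    _ ≡⟨ ∑-cong (allSubsets n) (λ A → ∑-cong (allSubsets n) (λ M →
           trans (𝟙-∧ (does (M ⊆? periphery G C)) (does (anchor G M C ≟ₛ A)) _)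
                 (𝟙-comm (does (M ⊆? periphery G C)) (does (anchor G M C ≟ₛ A)) _))) ⟩
    _ ≡⟨ ∑ₛ-fibres n (λ M → anchor G M C)
           (λ M A → 𝟙[ does (M ⊆? periphery G C) ] (x ^ ∣ M ∣ * nonSupersetPoly C A x)) ⟩
    _ ∎)
    where open ≡-Reasoning

proposition10 : ∀ {n} (G : Graph n) (C : Subset n) → IsClique G C →
    (maxDec : Dec (IsMaximalClique G C)) → (x : ℤ) →
    nbhPoly (addVertex G C) x
      ≡ nbhPoly G x + φ G C maxDec x
        + x * sumℤ (map (λ A → periphPoly G A C x
                                * ((1ℤ + x) ^ ∣ C ∣ - x ^ ∣ A ∣ * (1ℤ + x) ^ (∣ C ∣ ∸ ∣ A ∣)))
                        (filter (inAnchors? G C) (allSubsets n)))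
proposition10 {n} G C clique maxDec x = begin
  nbhPoly G⁺ x
    ≡⟨ ∑-filter (inNbhComplex? G⁺) (λ U → x ^ ∣ U ∣) (allSubsets (suc n)) ⟩
  ∑ₛ (suc n) (λ U → 𝟙[ does (inNbhComplex? G⁺ U) ] (x ^ ∣ U ∣))
    ≡⟨ ∑ₛ-suc n _ ⟩
  ∑ₛ n (λ U → 𝟙[ does (inNbhComplex? G⁺ (outside ∷ U)) ] (x ^ ∣ U ∣))
    + ∑ₛ n (λ W → 𝟙[ does (inNbhComplex? G⁺ (inside ∷ W)) ] (x ^ ∣ inside ∷ W ∣))
    ≡⟨ cong₂ _+_ (∑-faces-avoiding maxDec x) (∑-faces-containing x) ⟩
  _ ≡⟨ cong (λ t → nbhPoly G x + φ G C maxDec x + x * t) (∑-by-anchor x) ⟩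
  _ ∎
  where
  open ≡-Reasoning
  open AddVertex G C clique
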